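{- Let $k$ be a positive integer and let $(a_j)_{j\ge1}$ be the $[k]$-LID sequence, with the convention $a_j=0$ for $j\le0$. Then for all nonnegative integers $n$, \[ a_{n+1} = 1+\sum_{i=0}^{\lfloor (n+1)/(k+1)\rfloor} a_{n-i(k+1)}, \] and moreover $a_{n+1}=n+1$ if $n\le k$, while $a_{n+1}=a_n+a_{n-k}$ if $n\ge k+1$.
   Context: $[k]=\{1,\dots,k\}$. For a set $S$ of positive integers, the $S$-legal index difference ($S$-LID) sequence $(a_n)_{n\ge 1}$ is defined recursively: for each positive integer $n$, $a_n$ is the smallest positive integer that cannot be written as $\sum_{\ell\in L} a_\ell$ for some set $L \subseteq \{1,\dots,n-1\}$ such that $|i-j|\notin S$ for all $i,j\in L$ (the empty sum is $0$). -}

module Defs where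

open import Data.Nat using (ℕ; zero; suc; _≤_; _<_; ∣_-_∣)
open import Data.Integer using (ℤ; +_; -[1+_])
open import Data.List using (List; map)
open import Data.Nat.ListAction using (sum)
open import Relation.Binary.PropositionalEquality using (_≡_)
open import Data.List.Membership.Propositional using (_∈_)
open import Data.List.Relation.Unary.All using (All)
open import Data.List.Relation.Unary.Unique.Propositional using (Unique)
open import Data.Product using (Σ; _×_)
open import Relation.Nullary using (¬_)

[_] : ℕ → ℕ → Set
[ k ] d = (1 ≤ d) × (d ≤ k)

record LegalSet (S : ℕ → Set) (n : ℕ) : Set where
  field
    indices : List ℕ
    distinct : Unique indices
    inRange : All (λ i → (1 ≤ i) × (i < n)) indices
    legal : ∀ {i j} → i ∈ indices → j ∈ indices → ¬ S ∣ i - j ∣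

Representable : (S : ℕ → Set) → (ℕ → ℕ) → ℕ → ℕ → Set
Representable S a n m =
  Σ (LegalSet S n) λ L → sum (map a (LegalSet.indices L)) ≡ m

-- a (indexed by n ≥ 1; the value a 0 is irrelevant) is the S-LID sequence:
-- a_n is the smallest positive integer not representable by a legal sum of a_1..a_{n-1}.
IsLID : (S : ℕ → Set) → (ℕ → ℕ) → Set
IsLID S a = ∀ n → 1 ≤ n →
  (1 ≤ a n)
  × ¬ Representable S a n (a n)
  × (∀ m → 1 ≤ m → m < a n → Representable S a n m)

ext : (ℕ → ℕ) → ℤ → ℕ
ext a (+ zero) = 0
ext a (+ suc m) = a (suc m)
ext a -[1+ m ] = 0

-- Write β p = a_p + (a_{p-k} - 1) (with a_j = 0 for j ≤ 0). Every m ≤ β p is a legal sum of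
-- a_1, …, a_p: below a_p use a legal set of earlier indices, otherwise add the index p to a legal
-- set of indices < p - k representing m - a_p. Conversely, by strong induction every legal sum of
-- a_1, …, a_p is at most β p: drop p if it is used, and then all other indices are < p - k.
-- Hence a_{p+1} = β p + 1, i.e. a_{p+1} = p + 1 for p ≤ k and a_{p+1} = a_p + a_{p-k} for p > k;
-- unrolling the second recurrence in steps of k + 1 gives the closed formula.
module Submission where

open import Defs
open import Data.Nat using (ℕ; zero; suc; _+_; _*_; _∸_; _≤_; _<_; _/_; _%_; pred; ∣_-_∣; s≤s; s≤s⁻¹; z≤n; _<?_; _≤?_; _≟_; NonZero; >-nonZero)
open import Data.Nat.Properties
open import Data.Nat.DivMod using (m%n<n; m≡m%n+[m/n]*n)
open import Data.Nat.Induction using (<-rec)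
open import Data.Nat.ListAction using (sum)
open import Data.Nat.ListAction.Properties using (sum-↭)
open import Data.Integer using (+_; -_; _-_)
open import Data.Integer.Properties using (m-n≡m⊖n; ⊖-≥; ⊖-<)
open import Data.List using (List; []; _∷_; _++_; map; upTo; applyUpTo)
open import Data.List.Properties using (map-cong; map-upTo; map-applyUpTo)
import Data.List.Relation.Unary.All as All
open import Data.List.Relation.Unary.Any using (here; there)
open import Data.List.Relation.Unary.AllPairs using ([]; _∷_)
open import Data.List.Relation.Unary.Unique.Propositional using (Unique)
open import Data.List.Relation.Unary.Unique.Propositional.Properties using (Unique[x∷xs]⇒x∉xs)
open import Data.List.Relation.Binary.Permutation.Propositional using (_↭_; ↭-sym; ↭⇒↭ₛ)
open import Data.List.Relation.Binary.Permutation.Propositional.Properties using (shift; ∈-resp-↭; map⁺)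
open import Data.List.Relation.Binary.Permutation.Setoid.Properties using (Unique-resp-↭)
open import Data.List.Membership.Propositional using (_∈_)
open import Data.List.Membership.Propositional.Properties using (∈-∃++)
open import Data.List.Membership.DecPropositional _≟_ using (_∈?_)
open import Data.Product using (Σ; ∃; _×_; _,_; proj₁; proj₂)
open import Function using (_∘_)
open import Relation.Nullary using (¬_; yes; no; contradiction)
open import Relation.Binary.PropositionalEquality
  using (_≡_; refl; sym; trans; cong; cong₂; subst; setoid; module ≡-Reasoning)

∈-∃↭ : ∀ {A : Set} {x : A} {xs : List A} → x ∈ xs → ∃ λ ys → xs ↭ x ∷ ys
∈-∃↭ {x = x} x∈xs with ys , zs , refl ← ∈-∃++ x∈xs = ys ++ zs , shift x ys zs

m<n∸o⇒m+o<n : ∀ m n o → m < n ∸ o → m + o < n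
m<n∸o⇒m+o<n m n       zero    m<n   = subst (_< n) (sym (+-identityʳ m)) m<n
m<n∸o⇒m+o<n m (suc n) (suc o) m<n∸o = subst (_< suc n) (sym (+-suc m o)) (s≤s (m<n∸o⇒m+o<n m n o m<n∸o))

m<[1+m/n]*n : ∀ m n .{{_ : NonZero n}} → m < suc (m / n) * n
m<[1+m/n]*n m n = begin-strict
  m                   ≡⟨ m≡m%n+[m/n]*n m n ⟩
  m % n + m / n * n   <⟨ +-monoˡ-< (m / n * n) (m%n<n m n) ⟩
  n + m / n * n       ∎
  where open ≤-Reasoning

ext-neg : ∀ (a : ℕ → ℕ) d → ext a (- + d) ≡ 0
ext-neg a zero    = refl
ext-neg a (suc d) = refl

ext-∸ : ∀ (a : ℕ → ℕ) m n → ext a (+ m - + n) ≡ ext a (+ (m ∸ n))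
ext-∸ a m n with n ≤? m
... | yes n≤m = cong (ext a) (trans (m-n≡m⊖n m n) (⊖-≥ n≤m))
... | no n≰m  = begin
  ext a (+ m - + n)    ≡⟨ cong (ext a) (trans (m-n≡m⊖n m n) (⊖-< (≰⇒> n≰m))) ⟩
  ext a (- + (n ∸ m))  ≡⟨ ext-neg a (n ∸ m) ⟩
  0                    ≡⟨ cong (ext a ∘ +_) (sym (m≤n⇒m∸n≡0 (<⇒≤ (≰⇒> n≰m)))) ⟩
  ext a (+ (m ∸ n))    ∎
  where open ≡-Reasoning

legalSum : ∀ {S n} → (ℕ → ℕ) → LegalSet S n → ℕ
legalSum f L = sum (map f (LegalSet.indices L))

module _ {S : ℕ → Set} where
  open LegalSet

  empty : ∀ {n} → LegalSet S n
  empty = record { indices = [] ; distinct = [] ; inRange = All.[] ; legal = λ () }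

  index<bound : ∀ {n i} (L : LegalSet S n) → i ∈ indices L → i < n
  index<bound L i∈L = proj₂ (All.lookup (inRange L) i∈L)

  indices-0 : (L : LegalSet S 0) → indices L ≡ []
  indices-0 L with indices L | inRange L
  ... | []    | _                  = refl
  ... | _ ∷ _ | (_ , ()) All.∷ _

  restrict : ∀ {n m} (L : LegalSet S n) → (∀ {i} → i ∈ indices L → i < m) → LegalSet S m
  restrict L below = record
    { indices  = indices L
    ; distinct = distinct L
    ; inRange  = All.tabulate λ i∈L → proj₁ (All.lookup (inRange L) i∈L) , below i∈L
    ; legal    = legal L
    }

  weaken : ∀ {n m} → n ≤ m → LegalSet S n → LegalSet S m
  weaken n≤m L = restrict L λ i∈L → <-≤-trans (index<bound L i∈L) n≤m

  cons : ∀ {p} → ¬ S 0 → 1 ≤ p → (L : LegalSet S p) →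
         (∀ {j} → j ∈ indices L → ¬ S ∣ p - j ∣) → LegalSet S (suc p)
  cons {p} ¬S0 1≤p L sep = record
    { indices  = p ∷ indices L
    ; distinct = All.tabulate (λ j∈L p≡j → <⇒≢ (index<bound L j∈L) (sym p≡j)) ∷ distinct L
    ; inRange  = (1≤p , n<1+n p) All.∷ All.map (λ (1≤i , i<p) → 1≤i , m<n⇒m<1+n i<p) (inRange L)
    ; legal    = legal′
    }
    where
    legal′ : ∀ {i j} → i ∈ p ∷ indices L → j ∈ p ∷ indices L → ¬ S ∣ i - j ∣
    legal′ (here refl)  (here refl)  = ¬S0 ∘ subst S (∣n-n∣≡0 p)
    legal′ (here refl)  (there j∈L) = sep j∈L
    legal′ (there i∈L) (here refl)  = sep i∈L ∘ subst S (∣-∣-comm _ p)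
    legal′ (there i∈L) (there j∈L) = legal L i∈L j∈L

  uncons : ∀ {p} (L : LegalSet S (suc p)) → p ∈ indices L →
           Σ (LegalSet S p) λ L′ → (indices L ↭ p ∷ indices L′) × (∀ {j} → j ∈ indices L′ → ¬ S ∣ p - j ∣)
  uncons {p} L p∈L = L′ , perm , λ j∈ws → legal L p∈L (member j∈ws)
    where
    ws : List ℕ
    ws = proj₁ (∈-∃↭ p∈L)
    perm : indices L ↭ p ∷ ws
    perm = proj₂ (∈-∃↭ p∈L)
    unique : Unique (p ∷ ws)
    unique = Unique-resp-↭ (setoid ℕ) (↭⇒↭ₛ perm) (distinct L)
    member : ∀ {j} → j ∈ ws → j ∈ indices L
    member j∈ws = ∈-resp-↭ (↭-sym perm) (there j∈ws)
    below : ∀ {j} → j ∈ ws → j < p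
    below j∈ws = ≤∧≢⇒< (s≤s⁻¹ (index<bound L (member j∈ws)))
                       (λ j≡p → Unique[x∷xs]⇒x∉xs unique (subst (_∈ ws) j≡p j∈ws))
    L′ : LegalSet S p
    L′ = record
      { indices  = ws
      ; distinct = tail unique
      ; inRange  = All.tabulate λ j∈ws → proj₁ (All.lookup (inRange L) (member j∈ws)) , below j∈ws
      ; legal    = λ i∈ws j∈ws → legal L (member i∈ws) (member j∈ws)
      }
      where
      tail : Unique (p ∷ ws) → Unique ws
      tail (_ ∷ u) = u

module _ {k : ℕ} where
  open LegalSet

  far⇒∉[k] : ∀ {p j} → j + k < p → ¬ [ k ] ∣ p - j ∣
  far⇒∉[k] {p} {j} j+k<p (_ , ∣p-j∣≤k) = <⇒≱ k<p∸j (subst (_≤ k) (m≤n⇒∣n-m∣≡n∸m j≤p) ∣p-j∣≤k)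
    where
    j≤p : j ≤ p
    j≤p = ≤-trans (m≤m+n j k) (<⇒≤ j+k<p)
    k<p∸j : k < p ∸ j
    k<p∸j = m+n≤o⇒m≤o∸n (suc k) (subst (_≤ p) (cong suc (+-comm j k)) j+k<p)

  separated⇒<∸ : ∀ {p j} → j < p → ¬ [ k ] ∣ p - j ∣ → j < p ∸ k
  separated⇒<∸ {p} {j} j<p sep with j <? p ∸ k
  ... | yes j<p∸k = j<p∸k
  ... | no  j≮p∸k = contradiction (1≤p∸j , p∸j≤k) (sep ∘ subst [ k ] (sym (m≤n⇒∣n-m∣≡n∸m (<⇒≤ j<p))))
    where
    1≤p∸j : 1 ≤ p ∸ j
    1≤p∸j = m<n⇒0<n∸m j<p
    p∸j≤k : p ∸ j ≤ k
    p∸j≤k = m≤n+o⇒m∸n≤o p j (begin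
      p            ≤⟨ m≤n+m∸n p k ⟩
      k + (p ∸ k)  ≤⟨ +-monoʳ-≤ k (≮⇒≥ j≮p∸k) ⟩
      k + j        ≡⟨ +-comm k j ⟩
      j + k        ∎)
      where open ≤-Reasoning

  extend : ∀ {p} → 1 ≤ p → LegalSet [ k ] (p ∸ k) → LegalSet [ k ] (suc p)
  extend {p} 1≤p L = cons (λ { (() , _) }) 1≤p (weaken (m∸n≤m p k) L)
                          (λ j∈L → far⇒∉[k] (m<n∸o⇒m+o<n _ p k (index<bound L j∈L)))

  dropTop : ∀ {p} (L : LegalSet [ k ] (suc p)) → p ∈ indices L →
            Σ (LegalSet [ k ] (p ∸ k)) λ L′ → indices L ↭ p ∷ indices L′
  dropTop L p∈L with L′ , perm , sep ← uncons L p∈L =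
    restrict L′ (λ j∈L′ → separated⇒<∸ (index<bound L′ j∈L′) (sep j∈L′)) , perm

module LID (k : ℕ) (a : ℕ → ℕ) (lid : IsLID [ k ] a) where
  open LegalSet

  Rep : ℕ → ℕ → Set
  Rep = Representable [ k ] a

  e : ℕ → ℕ
  e n = ext a (+ n)

  e≡a : ∀ {n} → 1 ≤ n → e n ≡ a n
  e≡a {suc n} _ = refl

  e-pos : ∀ {n} → 1 ≤ n → 1 ≤ e n
  e-pos {suc n} 1≤n = proj₁ (lid (suc n) 1≤n)

  a-unrepresentable : ∀ p → ¬ Rep (suc p) (a (suc p))
  a-unrepresentable p = proj₁ (proj₂ (lid (suc p) (s≤s z≤n)))

  representable-<a : ∀ p m → 1 ≤ m → m < a (suc p) → Rep (suc p) m
  representable-<a p = proj₂ (proj₂ (lid (suc p) (s≤s z≤n)))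

  representable-≤pred : ∀ n m → m ≤ pred (e n) → Rep n m
  representable-≤pred n       zero    _ = empty , refl
  representable-≤pred zero    (suc m) ()
  representable-≤pred (suc p) (suc m) m<pred = representable-<a p (suc m) (s≤s z≤n) (pred-cancel-< m<pred)

  β : ℕ → ℕ
  β p = e p + pred (e (p ∸ k))

  representable-≤β : ∀ p m → m ≤ β p → Rep (suc p) m
  representable-≤β zero m m≤β rewrite 0∸n≡0 k | n≤0⇒n≡0 m≤β = empty , refl
  representable-≤β p@(suc _) m m≤β with m <? e p
  ... | yes m<ap = let L , ΣL≡m = representable-≤pred p m (<⇒≤pred m<ap) in weaken (n≤1+n p) L , ΣL≡m
  ... | no  m≮ap with L , ΣL≡r ← representable-≤pred (p ∸ k) (m ∸ e p) (m≤n+o⇒m∸n≤o m (e p) m≤β) =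
    extend (s≤s z≤n) L , trans (cong (_+_ (e p)) ΣL≡r) (m+[n∸m]≡n (≮⇒≥ m≮ap))

  Bounded : ℕ → Set
  Bounded n = (L : LegalSet [ k ] n) → legalSum a L ≤ pred (e n)

  legalSum-≤β : ∀ p → (∀ {m} → m ≤ p → Bounded m) → (L : LegalSet [ k ] (suc p)) → legalSum a L ≤ β p
  legalSum-≤β p bounded L with p ∈? indices L
  ... | no p∉L = begin
    legalSum a L  ≤⟨ bounded ≤-refl (restrict L below) ⟩
    pred (e p)    ≤⟨ pred[n]≤n ⟩
    e p           ≤⟨ m≤m+n (e p) _ ⟩
    β p           ∎
    where
    open ≤-Reasoning
    below : ∀ {i} → i ∈ indices L → i < p
    below i∈L = ≤∧≢⇒< (s≤s⁻¹ (index<bound L i∈L)) λ i≡p → p∉L (subst (_∈ indices L) i≡p i∈L)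
  ... | yes p∈L with L′ , perm ← dropTop L p∈L = begin
    legalSum a L        ≡⟨ sum-↭ (map⁺ a perm) ⟩
    a p + legalSum a L′ ≡⟨ cong (_+ legalSum a L′) (sym (e≡a (proj₁ (All.lookup (inRange L) p∈L)))) ⟩
    e p + legalSum a L′ ≤⟨ +-monoʳ-≤ (e p) (bounded (m∸n≤m p k) L′) ⟩
    β p                 ∎
    where open ≤-Reasoning

  a-suc-from-bound : ∀ p → ((L : LegalSet [ k ] (suc p)) → legalSum a L ≤ β p) → a (suc p) ≡ suc (β p)
  a-suc-from-bound p bound = ≤-antisym
    (≮⇒≥ λ β<a → let L , ΣL≡ = representable-<a p (suc (β p)) (s≤s z≤n) β<a
                  in <-irrefl refl (subst (_≤ β p) ΣL≡ (bound L)))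
    (≮⇒≥ λ a<sucβ → a-unrepresentable p (representable-≤β p (a (suc p)) (s≤s⁻¹ a<sucβ)))

  legalSum-bounded : ∀ n → Bounded n
  legalSum-bounded = <-rec Bounded step
    where
    step : ∀ n → (∀ {m} → m < n → Bounded m) → Bounded n
    step zero    _       L = ≤-reflexive (cong (sum ∘ map a) (indices-0 L))
    step (suc p) bounded L rewrite a-suc-from-bound p (legalSum-≤β p (bounded ∘ s≤s)) =
      legalSum-≤β p (bounded ∘ s≤s) L

  a-suc : ∀ p → a (suc p) ≡ suc (β p)
  a-suc p = a-suc-from-bound p (legalSum-≤β p λ _ → legalSum-bounded _)

  mutual
    a-suc-≤k : ∀ p → p ≤ k → a (suc p) ≡ suc p
    a-suc-≤k p p≤k = begin
      a (suc p)                     ≡⟨ a-suc p ⟩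
      suc (e p + pred (e (p ∸ k)))  ≡⟨ cong (λ d → suc (e p + pred (e d))) (m≤n⇒m∸n≡0 p≤k) ⟩
      suc (e p + 0)                 ≡⟨ cong suc (+-identityʳ (e p)) ⟩
      suc (e p)                     ≡⟨ cong suc (e-≤k p p≤k) ⟩
      suc p                         ∎
      where open ≡-Reasoning

    e-≤k : ∀ p → p ≤ k → e p ≡ p
    e-≤k zero    _     = refl
    e-≤k (suc p) 1+p≤k = a-suc-≤k p (≤-trans (n≤1+n p) 1+p≤k)

  a-suc->k : ∀ p → suc k ≤ p → a (suc p) ≡ e p + e (p ∸ k)
  a-suc->k p k<p = begin
    a (suc p)                     ≡⟨ a-suc p ⟩
    suc (e p + pred (e (p ∸ k)))  ≡⟨ sym (+-suc (e p) _) ⟩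
    e p + suc (pred (e (p ∸ k)))  ≡⟨ cong (_+_ (e p)) (suc-pred (e (p ∸ k)) {{>-nonZero (e-pos (m<n⇒0<n∸m k<p))}}) ⟩
    e p + e (p ∸ k)               ∎
    where open ≡-Reasoning

  strideSum : ℕ → ℕ → ℕ
  strideSum N n = sum (map (λ i → e (n ∸ i * suc k)) (upTo N))

  strideSum-suc : ∀ N n → strideSum (suc N) n ≡ e n + strideSum N (n ∸ suc k)
  strideSum-suc N n = cong (λ xs → e n + sum xs) (begin
    map f (applyUpTo suc N)            ≡⟨ map-applyUpTo suc f N ⟩
    applyUpTo (f ∘ suc) N              ≡⟨ sym (map-upTo (f ∘ suc) N) ⟩
    map (f ∘ suc) (upTo N)             ≡⟨ map-cong (λ i → cong e (sym (∸-+-assoc n (suc k) (i * suc k)))) (upTo N) ⟩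
    map (λ i → e (n ∸ suc k ∸ i * suc k)) (upTo N) ∎)
    where
    open ≡-Reasoning
    f : ℕ → ℕ
    f i = e (n ∸ i * suc k)

  strideSum-0 : ∀ N → strideSum N 0 ≡ 0
  strideSum-0 zero    = refl
  strideSum-0 (suc N) = trans (strideSum-suc N 0) (strideSum-0 N)

  a-suc≡strideSum : ∀ N n → n < N * suc k → a (suc n) ≡ suc (strideSum N n)
  a-suc≡strideSum (suc N) n n<N*k rewrite strideSum-suc N n with suc k ≤? n
  ... | no n≤k = begin
    a (suc n)                            ≡⟨ a-suc-≤k n (s≤s⁻¹ (≰⇒> n≤k)) ⟩
    suc n                                ≡⟨ cong suc (sym (e-≤k n (s≤s⁻¹ (≰⇒> n≤k)))) ⟩
    suc (e n)                            ≡⟨ cong suc (sym (+-identityʳ (e n))) ⟩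
    suc (e n + 0)                        ≡⟨ cong (λ s → suc (e n + s)) (sym (trans (cong (strideSum N) (m≤n⇒m∸n≡0 (≰⇒≥ n≤k))) (strideSum-0 N))) ⟩
    suc (e n + strideSum N (n ∸ suc k))  ∎
    where open ≡-Reasoning
  a-suc≡strideSum (suc N) n@(suc m) n<N*k | yes (s≤s k≤m) = begin
    a (suc n)                                   ≡⟨ a-suc->k n (s≤s k≤m) ⟩
    e n + e (n ∸ k)                             ≡⟨ cong (λ d → e n + e d) (+-∸-assoc 1 k≤m) ⟩
    e n + a (suc (m ∸ k))                       ≡⟨ cong (_+_ (e n)) (a-suc≡strideSum N (m ∸ k) m∸k<N*k) ⟩
    e n + suc (strideSum N (m ∸ k))             ≡⟨ +-suc (e n) _ ⟩
    suc (e n + strideSum N (n ∸ suc k))         ∎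
    where
    open ≡-Reasoning
    m∸k<N*k : m ∸ k < N * suc k
    m∸k<N*k = subst (n ∸ suc k <_) (m+n∸m≡n (suc k) (N * suc k)) (∸-monoˡ-< n<N*k (s≤s k≤m))

proposition2p7 : (k : ℕ) → 1 ≤ k → (a : ℕ → ℕ) → IsLID [ k ] a → (n : ℕ) →
    (a (suc n) ≡ 1 + sum (map (λ i → ext a (+ n - + (i * suc k))) (upTo (suc (suc n / suc k)))))
    × (n ≤ k → a (suc n) ≡ suc n)
    × (suc k ≤ n → a (suc n) ≡ a n + a (n ∸ k))
proposition2p7 k _ a lid n = closedForm , a-suc-≤k n , recurrence
  where
  open LID k a lid
  N : ℕ
  N = suc (suc n / suc k)

  closedForm : a (suc n) ≡ 1 + sum (map (λ i → ext a (+ n - + (i * suc k))) (upTo N))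
  closedForm = trans (a-suc≡strideSum N n (<-trans (n<1+n n) (m<[1+m/n]*n (suc n) (suc k))))
                     (cong (suc ∘ sum) (map-cong (λ i → sym (ext-∸ a n (i * suc k))) (upTo N)))

  recurrence : suc k ≤ n → a (suc n) ≡ a n + a (n ∸ k)
  recurrence k<n = trans (a-suc->k n k<n) (cong₂ _+_ (e≡a (≤-trans (s≤s z≤n) k<n)) (e≡a (m<n⇒0<n∸m k<n)))
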